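{- Let $\ell>0$ and $b\neq0$ be integers with $\ell^2+4b\geq0$, let $\mathbf{s}$ be defined by $s_0=0$, $s_1=1$, $s_j=\ell s_{j-1}+bs_{j-2}$ for $j\geq2$, and let $r=\gcd(\ell,b)$, $t=\gcd(\ell^2/r,\,b/r)$, $\sigma=r/t$. Define $f$ by $f_0=0$, $f_1=1$ and $f_n=\frac{\ell}{t}f_{n-1}+\frac{b}{t^2}f_{n-2}$ for $n\geq2$. Then $s_n=t^{n-1}f_n$ for all $n\geq0$, $f$ is an integer sequence, and $\gcd(f_{n+1},f_n)=\sigma^{\lfloor n/2\rfloor}$ (for $n\geq 1$). -}

module Defs where

open import Data.Nat as ℕ using (ℕ; zero; suc)
open import Data.Integer as ℤ using (ℤ)
open import Data.Nat.GCD using (gcd)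
open import Data.Rational as ℚ using (ℚ)

s : ℤ → ℤ → ℕ → ℤ
s ℓ b zero = ℤ.0ℤ
s ℓ b (suc zero) = ℤ.1ℤ
s ℓ b (suc (suc j)) = ℓ ℤ.* s ℓ b (suc j) ℤ.+ b ℤ.* s ℓ b j

-- natural-number division; the divisor-zero case is a dummy convention
-- (never reached under the hypotheses of the lemma, since b ≠ 0)
_÷_ : ℕ → ℕ → ℕ
m ÷ zero = 0
m ÷ suc k = m ℕ./ suc k

-- the rational number x / d (dummy value 0 when d = 0)
_/ℚ_ : ℤ → ℕ → ℚ
x /ℚ zero = ℚ.0ℚ
x /ℚ suc k = x ℚ./ suc k

r : ℤ → ℤ → ℕ
r ℓ b = gcd ℤ.∣ ℓ ∣ ℤ.∣ b ∣

-- t = gcd(ℓ²/r, b/r)   (gcd only depends on absolute values)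
t : ℤ → ℤ → ℕ
t ℓ b = gcd ((ℤ.∣ ℓ ∣ ℕ.* ℤ.∣ ℓ ∣) ÷ r ℓ b) (ℤ.∣ b ∣ ÷ r ℓ b)

σ : ℤ → ℤ → ℕ
σ ℓ b = r ℓ b ÷ t ℓ b

f : ℤ → ℤ → ℕ → ℚ
f ℓ b zero = ℚ.0ℚ
f ℓ b (suc zero) = ℚ.1ℚ
f ℓ b (suc (suc n)) =
  (ℓ /ℚ t ℓ b) ℚ.* f ℓ b (suc n) ℚ.+ (b /ℚ (t ℓ b ℕ.* t ℓ b)) ℚ.* f ℓ b n

module Submission where

-- The idea is to write ℓ = t·L and b = t²·B with integers L = σp, B = σβ,
-- where σ ⊥ β and p ⊥ β; then f and s are both governed by s L B.
--
-- If ℓ = cL and b = c²B then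
--     s ℓ b (n+1) = cⁿ · s L B (n+1); and if c = t ≠ 0 the coefficients ℓ/t,
--     b/t² of f are the integers L, B, so f = s L B.
-- (2) Consecutive gcds (module Consecutive).  For L = κp, B = κβ with κ ⊥ β
--     and p ⊥ β, the terms of g = s L B are g(2k) = κᵏ Aₖ, g(2k+1) = κᵏ Cₖ
--     for integer sequences A, C with Cₖ prime to κ, β and Aₖ, and Aₖ₊₁
--     prime to Cₖ; hence gcd(g(n+1), g n) = κ^⌊n/2⌋.
-- (3) Arithmetic of r, t, σ (modules Arithmetic, IntegerForm).  With
--     ∣ℓ∣ = pr, ∣b∣ = qr and p ⊥ q, t = gcd(p²r, q) is prime to p, so it
--     divides r and q; then r = σt, ∣b∣ = t²σβ' with σ ⊥ β' and p ⊥ β'.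
--
-- The theorem takes g = s (σp) (σβ) and combines the three parts.

open import Defs
open import Data.Nat as ℕ using (ℕ; suc; _≥_)
open import Data.Integer as ℤ using (ℤ; +_)
open import Data.Rational as ℚ using (ℚ)
open import Data.Integer.GCD using (gcd)
open import Data.Product using (Σ; _×_)
open import Relation.Binary.PropositionalEquality using (_≡_; _≢_)

open import Data.Nat using (zero; NonZero; ≢-nonZero)
open import Data.Integer using (∣_∣)
import Data.Nat.Properties as ℕP
import Data.Integer.Properties as ℤP
import Data.Nat.DivMod as ℕD
import Data.Nat.Divisibility as ℕ∣
import Data.Nat.GCD as ℕG
import Data.Nat.Coprimality as ℕC
open import Data.Integer.Coprimality using (Coprime)
import Data.Integer.Divisibility.Signed as ℤ∣
import Data.Rational.Properties as ℚP
import Data.Rational.Unnormalised as ℚᵘ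
import Data.Rational.Unnormalised.Properties as ℚᵘP
open import Data.Rational.Literals using (fromℤ)
open import Data.Product using (_,_; proj₁; proj₂)
open import Data.Sum using (_⊎_; inj₁; inj₂; reduce)
open import Data.Empty using (⊥-elim)
open import Relation.Binary.PropositionalEquality
  using (refl; sym; trans; cong; cong₂; subst; subst₂; module ≡-Reasoning)
open import Data.Integer.Tactic.RingSolver using (solve-∀)
import Data.Nat.Tactic.RingSolver as ℕSolver

open ≡-Reasoning

-- Scaling the coefficients of the recurrence, and the rational sequence f

module Scaling where
  open import Data.Integer using (_+_; _*_; _^_)

  s-scale : ∀ (c L B ℓ b : ℤ) → ℓ ≡ c * L → b ≡ c * (c * B) →
            ∀ n → s ℓ b (suc n) ≡ c ^ n * s L B (suc n)
  s-scale c L B _ _ refl refl n = proj₁ (consecutive n)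
    where
    P : ℕ → Set
    P n = s (c * L) (c * (c * B)) (suc n) ≡ c ^ n * s L B (suc n)

    first : ∀ c L B → c * L * ℤ.1ℤ + c * (c * B) * ℤ.0ℤ
                    ≡ c * ℤ.1ℤ * (L * ℤ.1ℤ + B * ℤ.0ℤ)
    first = solve-∀

    regroup : ∀ c L B cⁿ x y → c * L * (c * cⁿ * x) + c * (c * B) * (cⁿ * y)
                             ≡ c * (c * cⁿ) * (L * x + B * y)
    regroup = solve-∀

    consecutive : ∀ n → P n × P (suc n)
    consecutive zero = refl , first c L B
    consecutive (suc n) = proj₂ ih , (begin
        c * L * s (c * L) (c * (c * B)) (suc (suc n))
          + c * (c * B) * s (c * L) (c * (c * B)) (suc n)
      ≡⟨ cong₂ (λ x y → c * L * x + c * (c * B) * y) (proj₂ ih) (proj₁ ih) ⟩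
        c * L * (c ^ suc n * s L B (suc (suc n))) + c * (c * B) * (c ^ n * s L B (suc n))
      ≡⟨ regroup c L B (c ^ n) _ _ ⟩
        c ^ suc (suc n) * s L B (suc (suc (suc n))) ∎)
      where
      ih : P n × P (suc n)
      ih = consecutive n

  fromℤ-+ : ∀ x y → fromℤ x ℚ.+ fromℤ y ≡ fromℤ (x + y)
  fromℤ-+ x y = ℚP.toℚᵘ-injective (ℚᵘP.≃-trans (ℚP.toℚᵘ-homo-+ (fromℤ x) (fromℤ y))
    (ℚᵘ.*≡* (cong (_* ℤ.1ℤ) (cong₂ _+_ (ℤP.*-identityʳ x) (ℤP.*-identityʳ y)))))

  fromℤ-* : ∀ x y → fromℤ x ℚ.* fromℤ y ≡ fromℤ (x * y)
  fromℤ-* x y = ℚP.toℚᵘ-injective (ℚP.toℚᵘ-homo-* (fromℤ x) (fromℤ y))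

  /-exact : ∀ x d y → d ≢ 0 → x ≡ + d * y → x /ℚ d ≡ fromℤ y
  /-exact x zero y d≢0 _ = ⊥-elim (d≢0 refl)
  /-exact x d@(suc _) y _ x≡dy = ℚP.≃⇒≡ (ℚ.*≡* (ℤP.*-cancelʳ-≡ _ _ G (begin
      ℚ.↥ q * ℤ.1ℤ * G      ≡⟨ cong (_* G) (ℤP.*-identityʳ (ℚ.↥ q)) ⟩
      ℚ.↥ q * G             ≡⟨ ℚP.↥-/ x d ⟩
      x                     ≡⟨ x≡dy ⟩
      + d * y               ≡⟨ cong (_* y) (sym (ℚP.↧-/ x d)) ⟩
      ℚ.↧ q * G * y         ≡⟨ swap (ℚ.↧ q) G y ⟩
      y * ℚ.↧ q * G         ∎)))
    where
    q : ℚ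
    q = x ℚ./ d

    G : ℤ
    G = gcd x (+ d)

    instance
      G-nonZero : ℤ.NonZero G
      G-nonZero = ≢-nonZero (ℕG.gcd[m,n]≢0 ∣ x ∣ d (inj₂ (λ ())))

    swap : ∀ a g y → a * g * y ≡ y * a * g
    swap = solve-∀

  f-integral : ∀ ℓ b L B → t ℓ b ≢ 0 → ℓ ≡ + t ℓ b * L → b ≡ + t ℓ b * (+ t ℓ b * B) →
               ∀ n → f ℓ b n ≡ fromℤ (s L B n)
  f-integral ℓ b L B t≢0 ℓ≡tL b≡ttB n = proj₁ (consecutive n)
    where
    T : ℕ
    T = t ℓ b

    ℓ/t : ℓ /ℚ T ≡ fromℤ L
    ℓ/t = /-exact ℓ T L t≢0 ℓ≡tL

    b/t² : b /ℚ (T ℕ.* T) ≡ fromℤ B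
    b/t² = /-exact b (T ℕ.* T) B (λ tt≡0 → t≢0 (reduce (ℕP.m*n≡0⇒m≡0∨n≡0 T tt≡0)))
      (trans b≡ttB (trans (sym (ℤP.*-assoc (+ T) (+ T) B)) (cong (_* B) (sym (ℤP.pos-* T T)))))

    Q : ℕ → Set
    Q n = f ℓ b n ≡ fromℤ (s L B n)

    consecutive : ∀ n → Q n × Q (suc n)
    consecutive zero = refl , refl
    consecutive (suc n) = proj₂ ih , (begin
        (ℓ /ℚ T) ℚ.* f ℓ b (suc n) ℚ.+ (b /ℚ (T ℕ.* T)) ℚ.* f ℓ b n
      ≡⟨ cong₂ ℚ._+_ (cong₂ ℚ._*_ ℓ/t (proj₂ ih)) (cong₂ ℚ._*_ b/t² (proj₁ ih)) ⟩
        fromℤ L ℚ.* fromℤ (s L B (suc n)) ℚ.+ fromℤ B ℚ.* fromℤ (s L B n)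
      ≡⟨ cong₂ ℚ._+_ (fromℤ-* L _) (fromℤ-* B _) ⟩
        fromℤ (L * s L B (suc n)) ℚ.+ fromℤ (B * s L B n)
      ≡⟨ fromℤ-+ (L * s L B (suc n)) (B * s L B n) ⟩
        fromℤ (s L B (suc (suc n))) ∎)
      where
      ih : Q n × Q (suc n)
      ih = consecutive n

open Scaling

module IntegerCoprimality where
  open import Data.Integer using (_+_; _*_; _^_)

  coprime-* : ∀ x y z → Coprime x z → Coprime y z → Coprime (x * y) z
  coprime-* x y z x⊥z y⊥z {i} (i∣xy , i∣z) =
    y⊥z (ℕC.coprime-divisor i⊥x (subst (i ℕ∣.∣_) (ℤP.abs-* x y) i∣xy) , i∣z)
    where
    i⊥x : ℕC.Coprime i ∣ x ∣
    i⊥x (j∣i , j∣x) = x⊥z (j∣x , ℕ∣.∣-trans j∣i i∣z)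

  coprime-+-multiple : ∀ x m y → Coprime x y → y ℤ∣.∣ m → Coprime (x + m) y
  coprime-+-multiple x m y x⊥y y∣m {i} (i∣x+m , i∣y) = x⊥y (ℤ∣.∣⇒∣ᵤ i∣x , i∣y)
    where
    i∣x : + i ℤ∣.∣ x
    i∣x = ℤ∣.∣m+n∣n⇒∣m (ℤ∣.∣ᵤ⇒∣ i∣x+m) (ℤ∣.∣-trans (ℤ∣.∣ᵤ⇒∣ i∣y) y∣m)

  multiple-+-coprime : ∀ m x y → Coprime x y → y ℤ∣.∣ m → Coprime (m + x) y
  multiple-+-coprime m x y x⊥y y∣m =
    subst (λ z → Coprime z y) (ℤP.+-comm x m) (coprime-+-multiple x m y x⊥y y∣m)

  gcd-*-coprime : ∀ c {x y} → Coprime x y → gcd (c * x) (c * y) ≡ + ∣ c ∣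
  gcd-*-coprime c {x} {y} x⊥y = cong +_ (begin
    ℕG.gcd (∣ c * x ∣) (∣ c * y ∣)         ≡⟨ cong₂ ℕG.gcd (ℤP.abs-* c x) (ℤP.abs-* c y) ⟩
    ℕG.gcd (∣c∣ ℕ.* ∣ x ∣) (∣c∣ ℕ.* ∣ y ∣) ≡⟨ ℕG.c*gcd[m,n]≡gcd[cm,cn] ∣c∣ ∣ x ∣ ∣ y ∣ ⟨
    ∣c∣ ℕ.* ℕG.gcd ∣ x ∣ ∣ y ∣             ≡⟨ cong (∣c∣ ℕ.*_) (ℕC.coprime⇒gcd≡1 x⊥y) ⟩
    ∣c∣ ℕ.* 1                              ≡⟨ ℕP.*-identityʳ ∣c∣ ⟩
    ∣c∣                                    ∎)
    where
    ∣c∣ : ℕ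
    ∣c∣ = ∣ c ∣

  abs-^ : ∀ i k → ∣ i ^ k ∣ ≡ ∣ i ∣ ℕ.^ k
  abs-^ i zero = refl
  abs-^ i (suc k) = trans (ℤP.abs-* i (i ^ k)) (cong (∣ i ∣ ℕ.*_) (abs-^ i k))

open IntegerCoprimality

halving : ∀ n → n ≡ n ℕ./ 2 ℕ.* 2 ⊎ n ≡ suc (n ℕ./ 2 ℕ.* 2)
halving n with n ℕ.% 2 | ℕD.m≡m%n+[m/n]*n n 2 | ℕD.m%n<n n 2
... | 0 | n≡ | _ = inj₁ n≡
... | 1 | n≡ | _ = inj₂ n≡
... | suc (suc _) | _ | ℕ.s≤s (ℕ.s≤s ())

-- Consecutive gcds of s (κp) (κβ) when κ ⊥ β and p ⊥ β

module Consecutive (κ : ℕ) (p β : ℤ) (κ⊥β : Coprime (+ κ) β) (p⊥β : Coprime p β) where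
  open import Data.Integer using (_+_; _*_; _^_)

  K L B : ℤ
  K = + κ
  L = K * p
  B = K * β

  u : ℕ → ℤ
  u = s L B

  -- The cofactors of κᵏ in u(2k) and u(2k+1).
  A C : ℕ → ℤ
  A zero = ℤ.0ℤ
  A (suc k) = p * C k + β * A k
  C zero = ℤ.1ℤ
  C (suc k) = K * (p * A (suc k)) + β * C k

  Halves : ℕ → Set
  Halves k = u (k ℕ.* 2) ≡ K ^ k * A k × u (suc (k ℕ.* 2)) ≡ K ^ k * C k

  halves : ∀ k → Halves k
  halves zero = refl , refl
  halves (suc k) = even , odd
    where
    ih : Halves k
    ih = halves k

    even-step : ∀ K p β Kᵏ c a → K * p * (Kᵏ * c) + K * β * (Kᵏ * a)
                               ≡ K * Kᵏ * (p * c + β * a)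
    even-step = solve-∀

    odd-step : ∀ K p β Kᵏ a c → K * p * (K * Kᵏ * a) + K * β * (Kᵏ * c)
                              ≡ K * Kᵏ * (K * (p * a) + β * c)
    odd-step = solve-∀

    even : u (suc k ℕ.* 2) ≡ K ^ suc k * A (suc k)
    even = trans (cong₂ (λ x y → L * x + B * y) (proj₂ ih) (proj₁ ih))
                 (even-step K p β (K ^ k) (C k) (A k))

    odd : u (suc (suc k ℕ.* 2)) ≡ K ^ suc k * C (suc k)
    odd = trans (cong₂ (λ x y → L * x + B * y) even (proj₂ ih))
                (odd-step K p β (K ^ k) (A (suc k)) (C k))

  record Invariant (k : ℕ) : Set where
    field
      C⊥K : Coprime (C k) K
      C⊥β : Coprime (C k) β
      C⊥A : Coprime (C k) (A k)

  module Step {k : ℕ} (I : Invariant k) where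
    open Invariant I

    A⊥β : Coprime (A (suc k)) β
    A⊥β = coprime-+-multiple (p * C k) (β * A k) β (coprime-* p (C k) β p⊥β C⊥β)
                             (ℤ∣.∣m⇒∣m*n (A k) ℤ∣.∣-refl)

    A⊥C : Coprime (A (suc k)) (C k)
    A⊥C = multiple-+-coprime (p * C k) (β * A k) (C k)
                             (coprime-* β (A k) (C k) (ℕC.sym C⊥β) (ℕC.sym C⊥A))
                             (ℤ∣.∣n⇒∣m*n p ℤ∣.∣-refl)

    next : Invariant (suc k)
    next = record
      { C⊥K = multiple-+-coprime (K * (p * A (suc k))) (β * C k) K
                                 (coprime-* β (C k) K (ℕC.sym κ⊥β) C⊥K)
                                 (ℤ∣.∣m⇒∣m*n (p * A (suc k)) ℤ∣.∣-refl)
      ; C⊥β = coprime-+-multiple (K * (p * A (suc k))) (β * C k) β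
                                 (coprime-* K (p * A (suc k)) β κ⊥β
                                            (coprime-* p (A (suc k)) β p⊥β A⊥β))
                                 (ℤ∣.∣m⇒∣m*n (C k) ℤ∣.∣-refl)
      ; C⊥A = multiple-+-coprime (K * (p * A (suc k))) (β * C k) (A (suc k))
                                 (coprime-* β (C k) (A (suc k)) (ℕC.sym A⊥β) (ℕC.sym A⊥C))
                                 (ℤ∣.∣n⇒∣m*n K (ℤ∣.∣n⇒∣m*n p ℤ∣.∣-refl))
      }

  invariant : ∀ k → Invariant k
  invariant zero = record { C⊥K = ℕC.1-coprimeTo κ ; C⊥β = ℕC.1-coprimeTo ∣ β ∣
                          ; C⊥A = ℕC.1-coprimeTo 0 }
  invariant (suc k) = Step.next (invariant k)

  GcdAt : ℕ → ℕ → Set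
  GcdAt k m = gcd (u (suc m)) (u m) ≡ + (κ ℕ.^ k)

  gcd-even : ∀ k → GcdAt k (k ℕ.* 2)
  gcd-even k = begin
    gcd (u (suc (k ℕ.* 2))) (u (k ℕ.* 2)) ≡⟨ cong₂ gcd (proj₂ (halves k)) (proj₁ (halves k)) ⟩
    gcd (K ^ k * C k) (K ^ k * A k)       ≡⟨ gcd-*-coprime (K ^ k) (Invariant.C⊥A (invariant k)) ⟩
    + ∣ K ^ k ∣                          ≡⟨ cong +_ (abs-^ K k) ⟩
    + (κ ℕ.^ k)                          ∎

  gcd-odd : ∀ k → GcdAt k (suc (k ℕ.* 2))
  gcd-odd k = begin
    gcd (u (suc k ℕ.* 2)) (u (suc (k ℕ.* 2))) ≡⟨ cong₂ gcd u-even (proj₂ (halves k)) ⟩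
    gcd (K ^ k * (K * A (suc k))) (K ^ k * C k) ≡⟨ gcd-*-coprime (K ^ k) KA⊥C ⟩
    + ∣ K ^ k ∣                                 ≡⟨ cong +_ (abs-^ K k) ⟩
    + (κ ℕ.^ k)                                 ∎
    where
    I : Invariant k
    I = invariant k

    KA⊥C : Coprime (K * A (suc k)) (C k)
    KA⊥C = coprime-* K (A (suc k)) (C k) (ℕC.sym (Invariant.C⊥K I)) (Step.A⊥C I)

    u-even : u (suc k ℕ.* 2) ≡ K ^ k * (K * A (suc k))
    u-even = trans (proj₁ (halves (suc k))) (regroup K (K ^ k) (A (suc k)))
      where
      regroup : ∀ K Kᵏ a → K * Kᵏ * a ≡ Kᵏ * (K * a)
      regroup = solve-∀

  consecutive-gcd : ∀ n → gcd (u (suc n)) (u n) ≡ + (κ ℕ.^ (n ℕ./ 2))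
  consecutive-gcd n with halving n
  ... | inj₁ n≡2k   = subst (GcdAt (n ℕ./ 2)) (sym n≡2k) (gcd-even (n ℕ./ 2))
  ... | inj₂ n≡2k+1 = subst (GcdAt (n ℕ./ 2)) (sym n≡2k+1) (gcd-odd (n ℕ./ 2))

-- The arithmetic of r = gcd(ℓ, b), t and σ = r/t

module Arithmetic where
  open import Data.Nat using (_*_; _/_)
  open import Data.Nat.Divisibility using (_∣_)

  record Decomposition (l m T S : ℕ) : Set where
    field
      p β : ℕ
      T≢0 : T ≢ 0
      l≡TSp : l ≡ T * (S * p)
      m≡TTSβ : m ≡ T * (T * (S * β))
      S⊥β : ℕC.Coprime S β
      p⊥β : ℕC.Coprime p β

  module SecondGcd (p q R : ℕ) (p⊥q : ℕC.Coprime p q) (q≢0 : q ≢ 0) where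
    T : ℕ
    T = ℕG.gcd (p * (p * R)) q

    T≢0 : T ≢ 0
    T≢0 = ℕG.gcd[m,n]≢0 (p * (p * R)) q (inj₂ q≢0)

    instance
      T-nonZero : NonZero T
      T-nonZero = ≢-nonZero T≢0

    T∣q : T ∣ q
    T∣q = ℕG.gcd[m,n]∣n (p * (p * R)) q

    -- T is prime to p (it divides q), so the factor p² can be cancelled.
    T∣R : T ∣ R
    T∣R = ℕC.coprime-divisor T⊥p (ℕC.coprime-divisor T⊥p (ℕG.gcd[m,n]∣m (p * (p * R)) q))
      where
      T⊥p : ℕC.Coprime T p
      T⊥p (i∣T , i∣p) = p⊥q (i∣p , ℕ∣.∣-trans i∣T T∣q)

    -- A common factor i of R/T and q/T would make iT a common divisor of
    -- p²R and q, hence a divisor of T.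
    cofactors-coprime : ℕC.Coprime (R / T) (q / T)
    cofactors-coprime {i} (i∣R/T , i∣q/T) =
      ℕ∣.∣1⇒≡1 (ℕ∣.*-cancelʳ-∣ T (subst (i * T ∣_) (sym (ℕP.*-identityˡ T)) iT∣T))
      where
      iT∣T : i * T ∣ T
      iT∣T = ℕG.gcd-greatest
        (ℕ∣.∣n⇒∣m*n p (ℕ∣.∣n⇒∣m*n p (ℕ∣.m∣n/o⇒m*o∣n T∣R i∣R/T)))
        (ℕ∣.m∣n/o⇒m*o∣n T∣q i∣q/T)

    p⊥q/T : ℕC.Coprime p (q / T)
    p⊥q/T (i∣p , i∣q/T) = p⊥q (i∣p , ℕ∣.∣-trans i∣q/T (ℕ∣.m/n∣m T∣q))

    decomposition : ∀ {l m} → l ≡ p * R → m ≡ q * R → Decomposition l m T (R / T)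
    decomposition {l} {m} l≡pR m≡qR = record
      { p = p ; β = q / T ; T≢0 = T≢0
      ; l≡TSp = begin
          l                 ≡⟨ l≡pR ⟩
          p * R             ≡⟨ cong (p *_) R≡ST ⟩
          p * (R / T * T)   ≡⟨ rearrange-l p (R / T) T ⟩
          T * (R / T * p)   ∎
      ; m≡TTSβ = begin
          m                           ≡⟨ m≡qR ⟩
          q * R                       ≡⟨ cong₂ _*_ q≡βT R≡ST ⟩
          (q / T * T) * (R / T * T)   ≡⟨ rearrange-m (q / T) (R / T) T ⟩
          T * (T * (R / T * (q / T))) ∎
      ; S⊥β = cofactors-coprime
      ; p⊥β = p⊥q/T
      }
      where
      R≡ST : R ≡ R / T * T
      R≡ST = sym (ℕD.m/n*n≡m T∣R)

      q≡βT : q ≡ q / T * T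
      q≡βT = sym (ℕD.m/n*n≡m T∣q)

      rearrange-l : ∀ p S T → p * (S * T) ≡ T * (S * p)
      rearrange-l = ℕSolver.solve-∀

      rearrange-m : ∀ β S T → (β * T) * (S * T) ≡ T * (T * (S * β))
      rearrange-m = ℕSolver.solve-∀

  ÷-is-/ : ∀ m d .{{_ : NonZero d}} → m ÷ d ≡ m / d
  ÷-is-/ m (suc _) = refl

  -- With p = ∣ℓ∣/r and q = ∣b∣/r, t is the T of SecondGcd and σ = r/t.
  decompose : ∀ ℓ b → b ≢ ℤ.0ℤ → Decomposition ∣ ℓ ∣ ∣ b ∣ (t ℓ b) (σ ℓ b)
  decompose ℓ b b≢0 =
    subst₂ (Decomposition l m) (sym t≡T) (sym σ≡S) (decomposition l≡pR m≡qR)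
    where
    l m R : ℕ
    l = ∣ ℓ ∣
    m = ∣ b ∣
    R = ℕG.gcd l m

    m≢0 : m ≢ 0
    m≢0 m≡0 = b≢0 (ℤP.∣i∣≡0⇒i≡0 m≡0)

    instance
      R-nonZero : NonZero R
      R-nonZero = ≢-nonZero (ℕG.gcd[m,n]≢0 l m (inj₂ m≢0))

    p q : ℕ
    p = l / R
    q = m / R

    l≡pR : l ≡ p * R
    l≡pR = sym (ℕD.m/n*n≡m (ℕG.gcd[m,n]∣m l m))

    m≡qR : m ≡ q * R
    m≡qR = sym (ℕD.m/n*n≡m (ℕG.gcd[m,n]∣n l m))

    q≢0 : q ≢ 0
    q≢0 q≡0 = m≢0 (trans m≡qR (cong (_* R) q≡0))

    open SecondGcd p q R (ℕC.coprime-/gcd l m) q≢0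

    l²/R : (l * l) ÷ R ≡ p * (p * R)
    l²/R = begin
      (l * l) ÷ R             ≡⟨ ÷-is-/ (l * l) R ⟩
      (l * l) / R             ≡⟨ cong (λ x → x * x / R) l≡pR ⟩
      (p * R) * (p * R) / R   ≡⟨ cong (_/ R) (rearrange p R) ⟩
      p * (p * R) * R / R     ≡⟨ ℕD.m*n/n≡m (p * (p * R)) R ⟩
      p * (p * R)             ∎
      where
      rearrange : ∀ p R → (p * R) * (p * R) ≡ p * (p * R) * R
      rearrange = ℕSolver.solve-∀

    t≡T : t ℓ b ≡ T
    t≡T = cong₂ ℕG.gcd l²/R (÷-is-/ m R)

    σ≡S : σ ℓ b ≡ R / T
    σ≡S = trans (cong (R ÷_) t≡T) (÷-is-/ R T)

open Arithmetic

module IntegerForm where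
  open import Data.Integer using (_*_)

  sign-factor : ∀ i → Σ ℤ (λ ε → ∣ ε ∣ ≡ 1 × i ≡ ε * + ∣ i ∣)
  sign-factor (+ n) = ℤ.1ℤ , refl , sym (ℤP.*-identityˡ (+ n))
  sign-factor ℤ.-[1+ n ] = ℤ.-1ℤ , refl , sym (ℤP.-1*i≡-i (+ suc n))

  pos-*³ : ∀ a b c d → + (a ℕ.* (b ℕ.* (c ℕ.* d))) ≡ + a * (+ b * (+ c * + d))
  pos-*³ a b c d = trans (ℤP.pos-* a _) (cong (+ a *_)
                     (trans (ℤP.pos-* b _) (cong (+ b *_) (ℤP.pos-* c d))))

  record IntegralForm (ℓ b : ℤ) : Set where
    field
      p β : ℤ
      t≢0 : t ℓ b ≢ 0
      ℓ≡tL : ℓ ≡ + t ℓ b * (+ σ ℓ b * p)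
      b≡ttB : b ≡ + t ℓ b * (+ t ℓ b * (+ σ ℓ b * β))
      σ⊥β : Coprime (+ σ ℓ b) β
      p⊥β : Coprime p β

  integral-form : ∀ ℓ b → ℤ.0ℤ ℤ.< ℓ → b ≢ ℤ.0ℤ → IntegralForm ℓ b
  integral-form ℓ b 0<ℓ b≢0 = record
    { p = + p ; β = ε * + β ; t≢0 = T≢0
    ; ℓ≡tL = begin
        ℓ                   ≡⟨ ℤP.0≤i⇒+∣i∣≡i (ℤP.<⇒≤ 0<ℓ) ⟨
        + ∣ ℓ ∣             ≡⟨ cong +_ l≡TSp ⟩
        + (T ℕ.* (S ℕ.* p)) ≡⟨ ℤP.pos-* T (S ℕ.* p) ⟩
        + T * + (S ℕ.* p)   ≡⟨ cong (+ T *_) (ℤP.pos-* S p) ⟩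
        + T * (+ S * + p)   ∎
    ; b≡ttB = begin
        b                                 ≡⟨ b≡ε∣b∣ ⟩
        ε * + ∣ b ∣                       ≡⟨ cong (λ x → ε * + x) m≡TTSβ ⟩
        ε * + (T ℕ.* (T ℕ.* (S ℕ.* β)))   ≡⟨ cong (ε *_) (pos-*³ T T S β) ⟩
        ε * (+ T * (+ T * (+ S * + β)))   ≡⟨ move-unit ε (+ T) (+ S) (+ β) ⟩
        + T * (+ T * (+ S * (ε * + β)))   ∎
    ; σ⊥β = subst (ℕC.Coprime S) (sym ∣εβ∣≡β) S⊥β
    ; p⊥β = subst (ℕC.Coprime p) (sym ∣εβ∣≡β) p⊥β
    }
    where
    open Decomposition (decompose ℓ b b≢0)

    T S : ℕ
    T = t ℓ b
    S = σ ℓ b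

    ε : ℤ
    ε = proj₁ (sign-factor b)

    ∣ε∣≡1 : ∣ ε ∣ ≡ 1
    ∣ε∣≡1 = proj₁ (proj₂ (sign-factor b))

    b≡ε∣b∣ : b ≡ ε * + ∣ b ∣
    b≡ε∣b∣ = proj₂ (proj₂ (sign-factor b))

    move-unit : ∀ ε t s β → ε * (t * (t * (s * β))) ≡ t * (t * (s * (ε * β)))
    move-unit = solve-∀

    ∣εβ∣≡β : ∣ ε * + β ∣ ≡ β
    ∣εβ∣≡β = trans (ℤP.abs-* ε (+ β)) (trans (cong (ℕ._* β) ∣ε∣≡1) (ℕP.*-identityˡ β))

open IntegerForm

lemma3p8 : (ℓ b : ℤ) → ℤ.0ℤ ℤ.< ℓ → b ≢ ℤ.0ℤ → ℤ.0ℤ ℤ.≤ ℓ ℤ.* ℓ ℤ.+ (+ 4) ℤ.* b →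
    Σ (ℕ → ℤ) (λ g →
      ((n : ℕ) → f ℓ b n ≡ g n ℚ./ 1)
      × (s ℓ b 0 ≡ ℤ.0ℤ × f ℓ b 0 ≡ ℚ.0ℚ)
      × ((n : ℕ) → s ℓ b (suc n) ≡ (+ t ℓ b) ℤ.^ n ℤ.* g (suc n))
      × ((n : ℕ) → n ≥ 1 → gcd (g (suc n)) (g n) ≡ + (σ ℓ b ℕ.^ (n ℕ./ 2))))
lemma3p8 ℓ b 0<ℓ b≢0 _ =
  u , f≡u , (refl , refl) , s-scale (+ t ℓ b) L B ℓ b ℓ≡tL b≡ttB , λ n _ → consecutive-gcd n
  where
  open IntegralForm (integral-form ℓ b 0<ℓ b≢0)
  open Consecutive (σ ℓ b) p β σ⊥β p⊥β using (L; B; u; consecutive-gcd)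

  f≡u : ∀ n → f ℓ b n ≡ u n ℚ./ 1
  f≡u n = trans (f-integral ℓ b L B t≢0 ℓ≡tL b≡ttB n) (sym (ℚP.↥p/↧p≡p (fromℤ (u n))))
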